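{- Let $n\ge1$, $p$ a prime, $R\subset E_n=\{1,\dots,n\}$ and $S\subset E_n$. There exists exactly one subset of $\mathbb{Z}^n$ which is a positive, admissible, homogeneous $S$-adapted $p$-cone.
   Context: Indices of elements of $E_n$ and of coordinates of vectors in $\mathbb{Z}^n$ are read modulo $n$. For $T\subset E_n$ and $m\in E_n$ put $\delta_T^{(m)}=-1$ if $m\in T$ and $1$ otherwise. For $d\in E_n$, $T\subset E_n$, let $F^{(d)}_T(x)=\sum_{j=0}^{n-1}p^j\,\delta_T^{(d+j)}\,x_{d+j}$ ($x\in\mathbb{Z}^n$). An $S$-adapted $p$-cone is a subset $\mathcal{C}=\{x\in\mathbb{Z}^n: F^{(s)}_{T^{(s)}}(x)\le0\ \forall s\in S\}$ for some family $(T^{(s)})_{s\in S}$ of subsets of $E_n$ (one inequality for each starting index $s\in S$). Such a cone is called homogeneous if it admits such a family with all $T^{(s)}$ equal; admissible if each $T^{(s)}$ is admissible, where $T\subset E_n$ is admissible if for every $i\in E_n$ with $i+1\notin S$: when $i\notin R$ exactly one of $i,i+1$ lies in $T$, and when $i\in R$ either both or neither lie in $T$; positive if for every $s\in S$: $s-1\in T^{(s)}\iff s-1\in R$. (The properties are required simultaneously for one defining family.) -}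

module Defs where

open import Level using (0ℓ)
open import Data.Bool using (Bool; true; false)
open import Data.Nat as ℕ using (ℕ; zero; suc; NonZero; _∸_)
open import Data.Nat.DivMod using (_mod_)
open import Data.Fin using (Fin; toℕ)
open import Data.Fin.Subset using (Subset; _∈_; _∉_)
open import Data.Vec using (lookup)
open import Data.Integer as ℤ using (ℤ; +_; -_; _≤_)
open import Data.Product using (Σ; _×_)
open import Data.Sum using (_⊎_)
open import Function.Bundles using (_⇔_)
open import Relation.Binary.PropositionalEquality using (_≡_)
open import Relation.Unary using (Pred; _≐_)

-- Indices: E_n = {1,…,n} is modelled by Fin n = {0,…,n-1}; all index
-- arithmetic is modulo n.
module _ {n : ℕ} {{_ : NonZero n}} where

  shift : Fin n → ℕ → Fin n
  shift d j = (toℕ d ℕ.+ j) mod n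

  next : Fin n → Fin n
  next i = shift i 1

  prev : Fin n → Fin n
  prev i = shift i (n ∸ 1)

sumBelow : ℕ → (ℕ → ℤ) → ℤ
sumBelow zero    f = + 0
sumBelow (suc k) f = sumBelow k f ℤ.+ f k

δ : {n : ℕ} → Subset n → Fin n → ℤ
δ T m with lookup T m
... | true  = - (+ 1)
... | false = + 1

F : (n : ℕ) {{_ : NonZero n}} (p : ℕ) → Fin n → Subset n → (Fin n → ℤ) → ℤ
F n p d T x = sumBelow n (λ j → (+ (p ℕ.^ j)) ℤ.* (δ T (shift d j) ℤ.* x (shift d j)))

module _ (n : ℕ) {{_ : NonZero n}} (p : ℕ) (R S : Subset n) where

  -- a family (T^{(s)})_{s ∈ S}; values at s ∉ S are irrelevant
  Family : Set
  Family = Fin n → Subset n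

  ConeOf : Family → Pred (Fin n → ℤ) 0ℓ
  ConeOf T x = ∀ s → s ∈ S → F n p s (T s) x ≤ + 0

  Homogeneous : Family → Set
  Homogeneous T = ∀ s s′ → s ∈ S → s′ ∈ S → T s ≡ T s′

  AdmissibleSet : Subset n → Set
  AdmissibleSet T = ∀ i → next i ∉ S →
      (i ∉ R → (i ∈ T × next i ∉ T) ⊎ (i ∉ T × next i ∈ T))
    × (i ∈ R → (i ∈ T × next i ∈ T) ⊎ (i ∉ T × next i ∉ T))

  Admissible : Family → Set
  Admissible T = ∀ s → s ∈ S → AdmissibleSet (T s)

  Positive : Family → Set
  Positive T = ∀ s → s ∈ S → (prev s ∈ T s ⇔ prev s ∈ R)

  IsPosAdmHomCone : Pred (Fin n → ℤ) 0ℓ → Set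
  IsPosAdmHomCone C = Σ Family λ T →
    Homogeneous T × Admissible T × Positive T × (C ≐ ConeOf T)

module Submission where

-- Homogeneity reduces the cone to a single set T ⊆ E_n, and equal sets give equal cones.
-- For i + 1 ∉ S admissibility determines whether i ∈ T from whether i + 1 ∈ T (equally if
-- i ∈ R, oppositely otherwise), while positivity fixes s - 1 ∈ T ⇔ s - 1 ∈ R for s ∈ S.
-- Walking forward from any i to the first element of S, reached within n steps, the
-- membership of i is therefore forced; conversely the forced values form an admissible,
-- positive set. If S = ∅ no inequality is imposed and every family gives all of ℤⁿ.

open import Defs
open import Level using (0ℓ)
open import Data.Bool using (Bool; true; false; not; if_then_else_)
open import Data.Nat using (ℕ; zero; suc; NonZero; _+_; _∸_; _%_; _<_; _≤_; s≤s; >-nonZero⁻¹)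
open import Data.Nat.Properties using (+-assoc; +-comm; +-suc; m∸n+n≡m; m+[n∸m]≡n; ≤-refl; ≤-trans; <⇒≤; n≤1+n)
open import Data.Nat.DivMod using (m%n<n; %-distribˡ-+; m%n%n≡m%n; [m+n]%n≡m%n; m<n⇒m%n≡m)
open import Data.Nat.Primality using (Prime)
open import Data.Fin using (Fin; toℕ)
open import Data.Fin.Properties using (toℕ-fromℕ<; toℕ-injective; toℕ<n)
open import Data.Fin.Subset using (Subset; _∈_; _∉_)
open import Data.Integer as ℤ using (ℤ; +_)
open import Data.Product using (Σ; ∃-syntax; _×_; _,_; proj₁; proj₂)
open import Data.Sum using (_⊎_; inj₁; inj₂)
open import Data.Vec using (lookup; tabulate)
open import Data.Vec.Properties using ([]=⇒lookup; lookup⇒[]=; lookup∘tabulate; tabulate∘lookup; tabulate-cong)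
open import Function using (const)
open import Function.Bundles using (_⇔_; mk⇔; module Equivalence)
open import Relation.Binary.PropositionalEquality using (_≡_; refl; sym; trans; cong; subst; module ≡-Reasoning)
open import Relation.Nullary using (contradiction)
open import Relation.Unary using (Pred; _≐_)
open import Relation.Unary.Properties using (≐-refl; ≐-trans)

open Equivalence using (to; from)

module _ {n : ℕ} {{_ : NonZero n}} where

  [m%n+k]%n≡[m+k]%n : ∀ m k → (m % n + k) % n ≡ (m + k) % n
  [m%n+k]%n≡[m+k]%n m k = begin
    (m % n + k) % n          ≡⟨ %-distribˡ-+ (m % n) k n ⟩
    (m % n % n + k % n) % n  ≡⟨ cong (λ r → (r + k % n) % n) (m%n%n≡m%n m n) ⟩
    (m % n + k % n) % n      ≡⟨ %-distribˡ-+ m k n ⟨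
    (m + k) % n              ∎
    where open ≡-Reasoning

  toℕ-shift : ∀ (i : Fin n) k → toℕ (shift i k) ≡ (toℕ i + k) % n
  toℕ-shift i k = toℕ-fromℕ< (m%n<n (toℕ i + k) n)

  shift-shift : ∀ (i : Fin n) a b → shift (shift i a) b ≡ shift i (a + b)
  shift-shift i a b = toℕ-injective (begin
    toℕ (shift (shift i a) b)  ≡⟨ toℕ-shift (shift i a) b ⟩
    (toℕ (shift i a) + b) % n  ≡⟨ cong (λ r → (r + b) % n) (toℕ-shift i a) ⟩
    ((toℕ i + a) % n + b) % n  ≡⟨ [m%n+k]%n≡[m+k]%n (toℕ i + a) b ⟩
    (toℕ i + a + b) % n        ≡⟨ cong (_% n) (+-assoc (toℕ i) a b) ⟩
    (toℕ i + (a + b)) % n      ≡⟨ toℕ-shift i (a + b) ⟨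
    toℕ (shift i (a + b))      ∎)
    where open ≡-Reasoning

  shift-next : ∀ (i : Fin n) k → shift (next i) k ≡ shift i (suc k)
  shift-next i = shift-shift i 1

  shift-n : ∀ (i : Fin n) → shift i n ≡ i
  shift-n i = toℕ-injective (trans (toℕ-shift i n)
    (trans ([m+n]%n≡m%n (toℕ i) n) (m<n⇒m%n≡m (toℕ<n i))))

  next-prev : ∀ (i : Fin n) → next (prev i) ≡ i
  next-prev i = trans (shift-shift i (n ∸ 1) 1)
    (trans (cong (shift i) (m∸n+n≡m (>-nonZero⁻¹ n))) (shift-n i))

  prev-next : ∀ (i : Fin n) → prev (next i) ≡ i
  prev-next i = trans (shift-shift i 1 (n ∸ 1))
    (trans (cong (shift i) (m+[n∸m]≡n (>-nonZero⁻¹ n))) (shift-n i))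

  shift-suc-surjective : ∀ (i j : Fin n) → ∃[ k ] k < n × shift i (suc k) ≡ j
  shift-suc-surjective i j = k , m%n<n a n , toℕ-injective (begin
    toℕ (shift i (suc k))       ≡⟨ toℕ-shift i (suc k) ⟩
    (toℕ i + suc k) % n         ≡⟨ cong (_% n) (trans (+-comm (toℕ i) (suc k)) (sym (+-suc k (toℕ i)))) ⟩
    (a % n + suc (toℕ i)) % n   ≡⟨ [m%n+k]%n≡[m+k]%n a (suc (toℕ i)) ⟩
    (a + suc (toℕ i)) % n       ≡⟨ cong (_% n) (+-assoc (toℕ j) (n ∸ suc (toℕ i)) (suc (toℕ i))) ⟩
    (toℕ j + (n ∸ suc (toℕ i) + suc (toℕ i))) % n
                                ≡⟨ cong (λ r → (toℕ j + r) % n) (m∸n+n≡m (toℕ<n i)) ⟩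
    (toℕ j + n) % n             ≡⟨ [m+n]%n≡m%n (toℕ j) n ⟩
    toℕ j % n                   ≡⟨ m<n⇒m%n≡m (toℕ<n j) ⟩
    toℕ j                       ∎)
    where
    open ≡-Reasoning
    a = toℕ j + (n ∸ suc (toℕ i))
    k = a % n

module _ {k : ℕ} {x : Fin k} {V : Subset k} where

  ∈⇒lookup≡true : x ∈ V → lookup V x ≡ true
  ∈⇒lookup≡true = []=⇒lookup

  lookup≡true⇒∈ : lookup V x ≡ true → x ∈ V
  lookup≡true⇒∈ = lookup⇒[]= x V

  lookup≡false⇒∉ : lookup V x ≡ false → x ∉ V
  lookup≡false⇒∉ e x∈V with () ← trans (sym e) (∈⇒lookup≡true x∈V)

  ∉⇒lookup≡false : x ∉ V → lookup V x ≡ false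
  ∉⇒lookup≡false x∉V with lookup V x in e
  ... | true  = contradiction (lookup≡true⇒∈ e) x∉V
  ... | false = refl

module _ {k : ℕ} {x : Fin k} {V W : Subset k} where

  ⇔⇒lookup≡ : (x ∈ V ⇔ x ∈ W) → lookup V x ≡ lookup W x
  ⇔⇒lookup≡ x∈V⇔x∈W with lookup W x in e
  ... | true  = ∈⇒lookup≡true (from x∈V⇔x∈W (lookup≡true⇒∈ e))
  ... | false = ∉⇒lookup≡false (λ x∈V → lookup≡false⇒∉ e (to x∈V⇔x∈W x∈V))

  lookup≡⇒⇔ : lookup V x ≡ lookup W x → (x ∈ V ⇔ x ∈ W)
  lookup≡⇒⇔ e = mk⇔ (λ x∈V → lookup≡true⇒∈ (trans (sym e) (∈⇒lookup≡true x∈V)))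
                    (λ x∈W → lookup≡true⇒∈ (trans e (∈⇒lookup≡true x∈W)))

module _ {k : ℕ} {x y : Fin k} {V : Subset k} where

  both-or-neither : lookup V x ≡ lookup V y ⇔ ((x ∈ V × y ∈ V) ⊎ (x ∉ V × y ∉ V))
  both-or-neither = mk⇔ both-or-neither⁺ both-or-neither⁻
    where
    both-or-neither⁺ : lookup V x ≡ lookup V y → (x ∈ V × y ∈ V) ⊎ (x ∉ V × y ∉ V)
    both-or-neither⁺ e with lookup V x in vx
    ... | true  = inj₁ (lookup≡true⇒∈ vx , lookup≡true⇒∈ (sym e))
    ... | false = inj₂ (lookup≡false⇒∉ vx , lookup≡false⇒∉ (sym e))
    both-or-neither⁻ : (x ∈ V × y ∈ V) ⊎ (x ∉ V × y ∉ V) → lookup V x ≡ lookup V y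
    both-or-neither⁻ (inj₁ (x∈V , y∈V)) = trans (∈⇒lookup≡true x∈V) (sym (∈⇒lookup≡true y∈V))
    both-or-neither⁻ (inj₂ (x∉V , y∉V)) = trans (∉⇒lookup≡false x∉V) (sym (∉⇒lookup≡false y∉V))

  exactly-one : lookup V x ≡ not (lookup V y) ⇔ ((x ∈ V × y ∉ V) ⊎ (x ∉ V × y ∈ V))
  exactly-one = mk⇔ exactly-one⁺ exactly-one⁻
    where
    exactly-one⁺ : lookup V x ≡ not (lookup V y) → (x ∈ V × y ∉ V) ⊎ (x ∉ V × y ∈ V)
    exactly-one⁺ e with lookup V y in vy
    ... | true  = inj₂ (lookup≡false⇒∉ e , lookup≡true⇒∈ vy)
    ... | false = inj₁ (lookup≡true⇒∈ e , lookup≡false⇒∉ vy)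
    exactly-one⁻ : (x ∈ V × y ∉ V) ⊎ (x ∉ V × y ∈ V) → lookup V x ≡ not (lookup V y)
    exactly-one⁻ (inj₁ (x∈V , y∉V)) = trans (∈⇒lookup≡true x∈V) (sym (cong not (∉⇒lookup≡false y∉V)))
    exactly-one⁻ (inj₂ (x∉V , y∈V)) = trans (∉⇒lookup≡false x∉V) (sym (cong not (∈⇒lookup≡true y∈V)))

propagate : Bool → Bool → Bool
propagate r b = if r then b else not b

module _ (n : ℕ) {{_ : NonZero n}} (p : ℕ) (R S : Subset n) where

  PositiveSet : Subset n → Set
  PositiveSet V = ∀ s → s ∈ S → (prev s ∈ V ⇔ prev s ∈ R)

  Propagates : Subset n → Set
  Propagates V = ∀ i → next i ∉ S → lookup V i ≡ propagate (lookup R i) (lookup V (next i))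

  admissible⇔propagates : ∀ {V} → AdmissibleSet n p R S V ⇔ Propagates V
  admissible⇔propagates {V} = mk⇔ admissible⇒propagates propagates⇒admissible
    where
    admissible⇒propagates : AdmissibleSet n p R S V → Propagates V
    admissible⇒propagates adm i i+1∉S with lookup R i in r
    ... | true  = from both-or-neither (proj₂ (adm i i+1∉S) (lookup≡true⇒∈ r))
    ... | false = from exactly-one (proj₁ (adm i i+1∉S) (lookup≡false⇒∉ r))
    propagates⇒admissible : Propagates V → AdmissibleSet n p R S V
    propagates⇒admissible prop i i+1∉S =
      (λ i∉R → to exactly-one (propagate-at (∉⇒lookup≡false i∉R))) ,
      (λ i∈R → to both-or-neither (propagate-at (∈⇒lookup≡true i∈R)))
      where
      propagate-at : ∀ {r} → lookup R i ≡ r → lookup V i ≡ propagate r (lookup V (next i))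
      propagate-at refl = prop i i+1∉S

  -- Membership of i as imposed by positivity at the first element of S among i + 1, …, i + k + 1
  -- and transported back to i by admissibility (meaningful when that element exists).
  forced : ℕ → Fin n → Bool
  forced zero    i = lookup R i
  forced (suc k) i = if lookup S (next i) then lookup R i else propagate (lookup R i) (forced k (next i))

  lookup≡forced : ∀ {V} → Propagates V → PositiveSet V → ∀ k i → shift i (suc k) ∈ S → lookup V i ≡ forced k i
  lookup≡forced {V} prop pos zero i i+1∈S =
    subst (λ j → lookup V j ≡ lookup R j) (prev-next i) (⇔⇒lookup≡ (pos (next i) i+1∈S))
  lookup≡forced prop pos (suc k) i i+k+2∈S with lookup S (next i) in e
  ... | true  = lookup≡forced prop pos zero i (lookup≡true⇒∈ e)
  ... | false = trans (prop i (lookup≡false⇒∉ e)) (cong (propagate (lookup R i))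
      (lookup≡forced prop pos k (next i) (subst (_∈ S) (sym (shift-next i (suc k))) i+k+2∈S)))

  forced-stable : ∀ {j k} i → shift i (suc j) ∈ S → j ≤ k → forced k i ≡ forced j i
  forced-stable {zero}  {zero}  i _ _ = refl
  forced-stable {zero}  {suc k} i i+1∈S _ rewrite ∈⇒lookup≡true i+1∈S = refl
  forced-stable {suc j} {suc k} i i+j+2∈S (s≤s j≤k) with lookup S (next i)
  ... | true  = refl
  ... | false = cong (propagate (lookup R i))
      (forced-stable (next i) (subst (_∈ S) (sym (shift-next i (suc j))) i+j+2∈S) j≤k)

  reaches-S : ∀ {s} → s ∈ S → ∀ i → ∃[ d ] d < n × shift i (suc d) ∈ S
  reaches-S {s} s∈S i with shift-suc-surjective i s
  ... | d , d<n , i+d+1≡s = d , d<n , subst (_∈ S) (sym i+d+1≡s) s∈S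

  canonical : Subset n
  canonical = tabulate (forced n)

  lookup-canonical : ∀ {d} i → shift i (suc d) ∈ S → d < n → lookup canonical i ≡ forced d i
  lookup-canonical i i+d+1∈S d<n = trans (lookup∘tabulate (forced n) i) (forced-stable i i+d+1∈S (<⇒≤ d<n))

  forced-eventually : ∀ {s k} → s ∈ S → ∀ i → n ≤ k → forced k i ≡ lookup canonical i
  forced-eventually s∈S i n≤k with reaches-S s∈S i
  ... | d , d<n , i+d+1∈S =
    trans (forced-stable i i+d+1∈S (≤-trans (<⇒≤ d<n) n≤k)) (sym (lookup-canonical i i+d+1∈S d<n))

  canonical-propagates : ∀ {s} → s ∈ S → Propagates canonical
  canonical-propagates s∈S i i+1∉S = begin
    lookup canonical i                                  ≡⟨ forced-eventually s∈S i (n≤1+n n) ⟨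
    forced (suc n) i                                    ≡⟨ cong (λ b → if b then lookup R i else forced-after) (∉⇒lookup≡false i+1∉S) ⟩
    forced-after                                        ≡⟨ cong (propagate (lookup R i)) (forced-eventually s∈S (next i) ≤-refl) ⟩
    propagate (lookup R i) (lookup canonical (next i))  ∎
    where
    open ≡-Reasoning
    forced-after : Bool
    forced-after = propagate (lookup R i) (forced n (next i))

  canonical-positive : PositiveSet canonical
  canonical-positive s s∈S =
    lookup≡⇒⇔ (lookup-canonical (prev s) (subst (_∈ S) (sym (next-prev s)) s∈S) (>-nonZero⁻¹ n))

  canonical-unique : ∀ {s V} → s ∈ S → AdmissibleSet n p R S V → PositiveSet V → V ≡ canonical
  canonical-unique {V = V} s∈S adm pos = trans (sym (tabulate∘lookup V)) (tabulate-cong lookup≡forced-n)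
    where
    lookup≡forced-n : ∀ i → lookup V i ≡ forced n i
    lookup≡forced-n i with reaches-S s∈S i
    ... | d , d<n , i+d+1∈S = trans (lookup≡forced (to admissible⇔propagates adm) pos d i i+d+1∈S)
                                    (sym (forced-stable i i+d+1∈S (<⇒≤ d<n)))

  positiveSet-of-homogeneous : ∀ {T s} → Homogeneous n p R S T → Positive n p R S T → s ∈ S → PositiveSet (T s)
  positiveSet-of-homogeneous hom pos s∈S s′ s′∈S =
    subst (λ V → prev s′ ∈ V ⇔ prev s′ ∈ R) (hom s′ _ s′∈S s∈S) (pos s′ s′∈S)

  ConeOf-cong : ∀ {T T′} → (∀ s → s ∈ S → T s ≡ T′ s) → ConeOf n p R S T ≐ ConeOf n p R S T′
  ConeOf-cong T≡T′ =
    (λ {x} x∈C s s∈S → subst (λ V → F n p s V x ℤ.≤ + 0) (T≡T′ s s∈S) (x∈C s s∈S)) ,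
    (λ {x} x∈C s s∈S → subst (λ V → F n p s V x ℤ.≤ + 0) (sym (T≡T′ s s∈S)) (x∈C s s∈S))

proposition5p1p1 : (n : ℕ) {{_ : NonZero n}} (p : ℕ) → Prime p → (R S : Subset n) →
    Σ (Pred (Fin n → ℤ) 0ℓ) λ C →
      IsPosAdmHomCone n p R S C
      × (∀ (C′ : Pred (Fin n → ℤ) 0ℓ) → IsPosAdmHomCone n p R S C′ → C′ ≐ C)
proposition5p1p1 n p _ R S = ConeOf n p R S (const U) , isCone , unique
  where
  U : Subset n
  U = canonical n p R S

  isCone : IsPosAdmHomCone n p R S (ConeOf n p R S (const U))
  isCone = const U , (λ _ _ _ _ → refl) ,
    (λ _ s∈S → from (admissible⇔propagates n p R S) (canonical-propagates n p R S s∈S)) ,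
    canonical-positive n p R S , ≐-refl

  unique : ∀ C′ → IsPosAdmHomCone n p R S C′ → C′ ≐ ConeOf n p R S (const U)
  unique C′ (T , hom , adm , pos , C′≐) = ≐-trans C′≐ (ConeOf-cong n p R S λ s s∈S →
    canonical-unique n p R S s∈S (adm s s∈S) (positiveSet-of-homogeneous n p R S hom pos s∈S))
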